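{- $\mathcal P_+ = \mathcal P_- = \mathcal P_{cons}$.
   Context: For $\varepsilon\in\{ -1,1\}$ and positive integers $n>m$, let $D_\varepsilon(n,m)=n^n+\varepsilon (n-m)^{n-m}m^m$. For $\varepsilon\in\{ -1,1\}$, let $\mathcal P_\varepsilon$ be the set of primes $p$ for which there exist positive integers $n>m$ with $p\nmid m$ and $p^2\mid D_\varepsilon(n,m)$; write $\mathcal P_+=\mathcal P_1$ and $\mathcal P_-=\mathcal P_{ -1}$. For a prime $p$, an integer $x$ is a nonzero $p$th power modulo $p^2$ if $x\equiv a^p \pmod{p^2}$ for some integer $a$ and $x\not\equiv 0\pmod p$; two $p$th powers $x,y$ modulo $p^2$ are consecutive if $y-x\equiv \pm1\pmod{p^2}$. Let $\mathcal P_{cons}$ be the set of primes $p$ for which there exist two consecutive nonzero $p$th powers modulo $p^2$. -}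

module Defs where

open import Data.Nat using (ℕ; _<_)
open import Data.Nat.Primality using (Prime)
open import Data.Integer using (ℤ; +_; _+_; _-_; _*_; _^_; 1ℤ)
open import Data.Integer.Divisibility using (_∣_)
open import Data.Product using (Σ; ∃; _×_)
open import Data.Sum using (_⊎_)
open import Relation.Nullary using (¬_)
open import Relation.Binary.PropositionalEquality using (_≡_)
open import Function.Bundles using (_⇔_)

data Sign : Set where
  plus minus : Sign

-- D_ε(n,m) = n^n + ε (n-m)^(n-m) m^m, for n > m (computed in ℤ; n ∸ m is exact since m < n)
D : Sign → ℕ → ℕ → ℤ
D plus  n m = (+ n) ^ n + ((+ (n Data.Nat.∸ m)) ^ (n Data.Nat.∸ m)) * ((+ m) ^ m)
D minus n m = (+ n) ^ n - ((+ (n Data.Nat.∸ m)) ^ (n Data.Nat.∸ m)) * ((+ m) ^ m)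

_≡[mod_]_ : ℤ → ℕ → ℤ → Set
x ≡[mod k ] y = (+ k) ∣ (x - y)

InP : Sign → ℕ → Set
InP ε p = Prime p × (∃ λ n → ∃ λ m → (0 < m) × (m < n) ×
            (¬ ((+ p) ∣ (+ m))) × ((+ (p Data.Nat.* p)) ∣ D ε n m))

NonzeroPthPowerMod : ℕ → ℤ → Set
NonzeroPthPowerMod p x =
  (∃ λ (a : ℤ) → x ≡[mod (p Data.Nat.* p) ] (a ^ p)) × (¬ ((+ p) ∣ x))

InCons : ℕ → Set
InCons p = Prime p × (∃ λ (x : ℤ) → ∃ λ (y : ℤ) →
  NonzeroPthPowerMod p x × NonzeroPthPowerMod p y ×
  ((y - x) ≡[mod (p Data.Nat.* p) ] 1ℤ ⊎ (y - x) ≡[mod (p Data.Nat.* p) ] (Data.Integer.- 1ℤ)))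

-- Write n = k + m, so that p² ∣ D_ε(n, m) says n^n ≡ −ε k^k m^m (mod p²).
--
-- Let p be odd and r = p − 1. For p ∤ z Fermat gives z^r = 1 + p t, hence
-- (z^r)^e ≡ 1 + e (z^r − 1) (mod p²). Raising the congruence to the even power r removes the sign,
-- and this linearisation turns it into n^p ≡ k^p + m^p (mod p²); dividing by n^p exhibits the
-- consecutive p-th powers (−m/n)^p and (k/n)^p.
--
-- Conversely, nonzero p-th powers modulo p² are r-th roots of unity, so two consecutive ones give
-- roots A, B with A + B ≡ 1. Choosing k ≡ A, m ≡ B (mod p²) and k ≡ e₁, m ≡ e₂ (mod r), which is
-- possible because p² ≡ 1 (mod r), makes (k + m)^(k+m) ≡ 1 and k^k m^m ≡ A^e₁ B^e₂. It remains to
-- reach −ε as A^e₁ B^e₂: e₁ = e₂ = 0 gives 1, and −1 is found by a 2-adic descent using that ±1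
-- are the only square roots of 1 modulo p², after replacing (A, B) by (−A/B, 1/B) when both A
-- and B have odd order.
--
-- For p = 2 both sets are empty: k, m and k + m cannot all be odd, and two odd numbers never
-- differ by ±1 modulo 4.

{-# OPTIONS --safe #-}
module Submission where

open import Algebra.Bundles using (CommutativeSemiring)
open import Data.Empty using (⊥-elim)
open import Data.Fin as Fin using (Fin; toℕ; fromℕ; inject₁)
open import Data.Fin.Properties using (toℕ<n; toℕ-fromℕ; toℕ-inject₁)
open import Data.Integer using (ℤ; +_; -[1+_]; -_; _+_; _-_; _*_; _^_; 0ℤ; 1ℤ; -1ℤ)
import Data.Integer as ℤ
open import Data.Integer.DivMod using (_%ℕ_; _/ℕ_; a≡a%ℕn+[a/ℕn]*n)
open import Data.Integer.Divisibility.Signed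
open import Data.Integer.Properties
  using ( +-*-commutativeSemiring; +-0-monoid; pos-+; pos-*; abs-*; suc-*; neg-involutive; neg-distribˡ-*
        ; +-identityʳ; *-identityˡ; *-identityʳ; *-zeroˡ; *-zeroʳ; *-assoc; *-comm
        ; ^-zeroˡ; ^-*-assoc; ^-distribˡ-+-* )
open import Data.Integer.Tactic.RingSolver using (solve-∀)
open import Data.Nat as ℕ using (ℕ; zero; suc; _∸_)
open import Data.Nat.Combinatorics using (_C_; nCn≡1; nC1≡n; nCk+nC[k+1]≡[n+1]C[k+1])
import Data.Nat.Divisibility as ℕ
open import Data.Nat.Induction using (<-rec)
open import Data.Nat.Primality using (Prime; euclidsLemma; ¬prime[0]; ¬prime[1]; prime[2]; prime⇒irreducible)
import Data.Nat.Properties as ℕ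
import Data.Nat.Tactic.RingSolver as ℕ-Solver
open import Data.Product using (∃; _,_; _×_; proj₁; proj₂)
open import Data.Sum using (_⊎_; inj₁; inj₂; [_,_]′)
open import Data.Vec.Functional using (Vector; init; last; tail)
open import Function using (_∘_; flip)
open import Function.Bundles using (_⇔_; mk⇔)
open import Relation.Binary.Bundles using (Setoid)
open import Relation.Binary.PropositionalEquality
open import Relation.Nullary using (¬_)

open import Defs

open import Algebra.Definitions.RawSemiring (CommutativeSemiring.rawSemiring +-*-commutativeSemiring)
  using () renaming (_×_ to _×ₛ_)
open import Algebra.Properties.CommutativeSemiring.Exp +-*-commutativeSemiring
  using () renaming (_^_ to _^ₛ_; ^-distrib-* to ^ₛ-distrib-*)
open import Algebra.Properties.CommutativeSemiring.Binomial +-*-commutativeSemiring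
  using (binomialTerm) renaming (theorem to binomial-theorem)
open import Algebra.Properties.Monoid.Sum +-0-monoid using (sum; sum-init-last)

-- Congruences

-- The relation _≡[mod_]_ of Defs, through signed divisibility and wrapped in a record so that
-- both sides can be inferred.
infix 4 _≡_[mod_]

record _≡_[mod_] (x y : ℤ) (n : ℕ) : Set where
  constructor from-∣
  field to-∣ : + n ∣ x - y
open _≡_[mod_] public

module _ {n : ℕ} where

  private
    N : ℤ
    N = + n

    x-0≡x : ∀ x → x - 0ℤ ≡ x
    x-0≡x = solve-∀

  mod-reflexive : ∀ {x y} → x ≡ y → x ≡ y [mod n ]
  mod-reflexive {x} refl = from-∣ (divides 0ℤ (x-x≡0*N x N))
    where
    x-x≡0*N : ∀ x N → x - x ≡ 0ℤ * N
    x-x≡0*N = solve-∀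

  mod-refl : ∀ {x} → x ≡ x [mod n ]
  mod-refl = mod-reflexive refl

  mod-sym : ∀ {x y} → x ≡ y [mod n ] → y ≡ x [mod n ]
  mod-sym {x} {y} (from-∣ d) = from-∣ (subst (N ∣_) (neg-diff x y) (∣m⇒∣-m d))
    where
    neg-diff : ∀ x y → - (x - y) ≡ y - x
    neg-diff = solve-∀

  mod-trans : ∀ {x y z} → x ≡ y [mod n ] → y ≡ z [mod n ] → x ≡ z [mod n ]
  mod-trans {x} {y} {z} (from-∣ d) (from-∣ e) = from-∣ (subst (N ∣_) (telescope x y z) (∣m∣n⇒∣m+n d e))
    where
    telescope : ∀ x y z → (x - y) + (y - z) ≡ x - z
    telescope = solve-∀

  +-cong-mod : ∀ {x y u v} → x ≡ y [mod n ] → u ≡ v [mod n ] → x + u ≡ y + v [mod n ]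
  +-cong-mod {x} {y} {u} {v} (from-∣ d) (from-∣ e) = from-∣ (subst (N ∣_) (regroup x y u v) (∣m∣n⇒∣m+n d e))
    where
    regroup : ∀ x y u v → (x - y) + (u - v) ≡ (x + u) - (y + v)
    regroup = solve-∀

  -‿cong-mod : ∀ {x y} → x ≡ y [mod n ] → - x ≡ - y [mod n ]
  -‿cong-mod {x} {y} (from-∣ d) = from-∣ (subst (N ∣_) (regroup x y) (∣m⇒∣-m d))
    where
    regroup : ∀ x y → - (x - y) ≡ - x - - y
    regroup = solve-∀

  *-cong-mod : ∀ {x y u v} → x ≡ y [mod n ] → u ≡ v [mod n ] → x * u ≡ y * v [mod n ]
  *-cong-mod {x} {y} {u} {v} (from-∣ d) (from-∣ e) =
    from-∣ (subst (N ∣_) (regroup x y u v) (∣m∣n⇒∣m+n (∣m⇒∣m*n u d) (∣n⇒∣m*n y e)))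
    where
    regroup : ∀ x y u v → (x - y) * u + y * (u - v) ≡ x * u - y * v
    regroup = solve-∀

  *-congˡ-mod : ∀ x {u v} → u ≡ v [mod n ] → x * u ≡ x * v [mod n ]
  *-congˡ-mod x = *-cong-mod (mod-refl {x})

  *-congʳ-mod : ∀ u {x y} → x ≡ y [mod n ] → x * u ≡ y * u [mod n ]
  *-congʳ-mod u eq = *-cong-mod eq (mod-refl {u})

  ^-congˡ-mod : ∀ {x y} e → x ≡ y [mod n ] → x ^ e ≡ y ^ e [mod n ]
  ^-congˡ-mod zero    _  = mod-refl
  ^-congˡ-mod (suc e) eq = *-cong-mod eq (^-congˡ-mod e eq)

  ∣⇒≡0-mod : ∀ {x} → N ∣ x → x ≡ 0ℤ [mod n ]
  ∣⇒≡0-mod {x} = from-∣ ∘ subst (N ∣_) (sym (x-0≡x x))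

  ≡0-mod⇒∣ : ∀ {x} → x ≡ 0ℤ [mod n ] → N ∣ x
  ≡0-mod⇒∣ {x} (from-∣ d) = subst (N ∣_) (x-0≡x x) d

  ∣-resp-mod : ∀ {x y} → x ≡ y [mod n ] → N ∣ x → N ∣ y
  ∣-resp-mod {x} {y} (from-∣ d) n∣x = subst (N ∣_) (cancel x y) (∣m∣n⇒∣m-n n∣x d)
    where
    cancel : ∀ x y → x - (x - y) ≡ y
    cancel = solve-∀

  mod-setoid : Setoid _ _
  mod-setoid = record
    { Carrier = ℤ
    ; _≈_ = _≡_[mod n ]
    ; isEquivalence = record { refl = mod-refl ; sym = mod-sym ; trans = mod-trans }
    }

≡[mod]⇒≡-mod : ∀ {n x y} → x ≡[mod n ] y → x ≡ y [mod n ]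
≡[mod]⇒≡-mod = from-∣ ∘ ∣ᵤ⇒∣

≡-mod⇒≡[mod] : ∀ {n x y} → x ≡ y [mod n ] → x ≡[mod n ] y
≡-mod⇒≡[mod] = ∣⇒∣ᵤ ∘ to-∣

mod-weaken : ∀ {m n x y} → m ℕ.∣ n → x ≡ y [mod n ] → x ≡ y [mod m ]
mod-weaken m∣n (from-∣ d) = from-∣ (∣-trans (∣ᵤ⇒∣ m∣n) d)

-- The library states the binomial theorem with the generic semiring power _^ₛ_ and multiple _×ₛ_.
^ₛ≡^ : ∀ x e → x ^ₛ e ≡ x ^ e
^ₛ≡^ x zero    = refl
^ₛ≡^ x (suc e) = cong (x *_) (^ₛ≡^ x e)

^-distribʳ-* : ∀ x y e → (x * y) ^ e ≡ x ^ e * y ^ e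
^-distribʳ-* x y e = begin
  (x * y) ^ e        ≡⟨ sym (^ₛ≡^ (x * y) e) ⟩
  (x * y) ^ₛ e       ≡⟨ ^ₛ-distrib-* x y e ⟩
  x ^ₛ e * y ^ₛ e    ≡⟨ cong₂ _*_ (^ₛ≡^ x e) (^ₛ≡^ y e) ⟩
  x ^ e * y ^ e ∎
  where open ≡-Reasoning

^-comm-exponents : ∀ x a b → (x ^ a) ^ b ≡ (x ^ b) ^ a
^-comm-exponents x a b =
  trans (^-*-assoc x a b) (trans (cong (x ^_) (ℕ.*-comm a b)) (sym (^-*-assoc x b a)))

square-^ : ∀ x h → (x * x) ^ h ≡ x ^ (h ℕ.+ h)
square-^ x h = trans (^-distribʳ-* x x h) (sym (^-distribˡ-+-* x h h))

-‿^-even : ∀ x h → (- x) ^ (h ℕ.+ h) ≡ x ^ (h ℕ.+ h)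
-‿^-even x h = begin
  (- x) ^ (h ℕ.+ h)    ≡⟨ sym (square-^ (- x) h) ⟩
  (- x * - x) ^ h      ≡⟨ cong (_^ h) (neg*neg x) ⟩
  (x * x) ^ h          ≡⟨ square-^ x h ⟩
  x ^ (h ℕ.+ h) ∎
  where
  open ≡-Reasoning
  neg*neg : ∀ x → - x * - x ≡ x * x
  neg*neg = solve-∀

-‿^-odd : ∀ x h → (- x) ^ suc (h ℕ.+ h) ≡ - x ^ suc (h ℕ.+ h)
-‿^-odd x h = trans (cong (- x *_) (-‿^-even x h)) (sym (neg-distribˡ-* x (x ^ (h ℕ.+ h))))

0^[1+n]≡0 : ∀ n → 0ℤ ^ suc n ≡ 0ℤ
0^[1+n]≡0 n = *-zeroˡ (0ℤ ^ n)

∣⇒∣^ : ∀ {d x} → d ∣ x → ∀ {e} → 0 ℕ.< e → d ∣ x ^ e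
∣⇒∣^ {x = x} d∣x {suc e} _ = ∣m⇒∣m*n (x ^ e) d∣x

∣-neg : ∀ {d x} → d ∣ - x → d ∣ x
∣-neg {d} {x} d∣-x = subst (d ∣_) (neg-involutive x) (∣m⇒∣-m d∣-x)

module _ {n : ℕ} where

  open import Relation.Binary.Reasoning.Setoid (mod-setoid {n})

  ^-*-≡1-mod : ∀ {x} s t → x ^ s ≡ 1ℤ [mod n ] → x ^ (s ℕ.* t) ≡ 1ℤ [mod n ]
  ^-*-≡1-mod {x} s t xˢ≡1 = begin
    x ^ (s ℕ.* t)  ≡⟨ sym (^-*-assoc x s t) ⟩
    (x ^ s) ^ t    ≈⟨ ^-congˡ-mod t xˢ≡1 ⟩
    1ℤ ^ t         ≡⟨ ^-zeroˡ t ⟩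
    1ℤ ∎

  ^-periodic-mod : ∀ {x} L e c → x ^ L ≡ 1ℤ [mod n ] → x ^ (e ℕ.+ L ℕ.* c) ≡ x ^ e [mod n ]
  ^-periodic-mod {x} L e c xᴸ≡1 = begin
    x ^ (e ℕ.+ L ℕ.* c)     ≡⟨ ^-distribˡ-+-* x e (L ℕ.* c) ⟩
    x ^ e * x ^ (L ℕ.* c)   ≈⟨ *-congˡ-mod (x ^ e) (^-*-≡1-mod L c xᴸ≡1) ⟩
    x ^ e * 1ℤ              ≡⟨ *-identityʳ (x ^ e) ⟩
    x ^ e ∎

  inverse-^-≡1-mod : ∀ {x y} e → x * y ≡ 1ℤ [mod n ] → x ^ e ≡ 1ℤ [mod n ] → y ^ e ≡ 1ℤ [mod n ]
  inverse-^-≡1-mod {x} {y} e xy≡1 xᵉ≡1 = begin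
    y ^ e             ≡⟨ sym (*-identityˡ (y ^ e)) ⟩
    1ℤ * y ^ e        ≈⟨ *-congʳ-mod (y ^ e) (mod-sym xᵉ≡1) ⟩
    x ^ e * y ^ e     ≡⟨ sym (^-distribʳ-* x y e) ⟩
    (x * y) ^ e       ≈⟨ ^-congˡ-mod e xy≡1 ⟩
    1ℤ ^ e            ≡⟨ ^-zeroˡ e ⟩
    1ℤ ∎

k+bn≡a+tn⇒k≡a : ∀ {k a n} b t → k ℕ.+ b ℕ.* n ≡ a ℕ.+ t ℕ.* n → + k ≡ + a [mod n ]
k+bn≡a+tn⇒k≡a {k} {a} {n} b t eq = from-∣ (divides (+ t - + b) (begin
  + k - + a                            ≡⟨ shift (+ k) (+ a) (+ b) (+ n) ⟩
  (+ k + + b * + n) - + a - + b * + n  ≡⟨ cong (λ z → z - + a - + b * + n) ℤ-eq ⟩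
  (+ a + + t * + n) - + a - + b * + n  ≡⟨ collect (+ a) (+ t) (+ b) (+ n) ⟩
  (+ t - + b) * + n ∎))
  where
  open ≡-Reasoning
  ℤ-eq : + k + + b * + n ≡ + a + + t * + n
  ℤ-eq = trans (sym (pos-lin k b n)) (trans (cong +_ eq) (pos-lin a t n))
    where
    pos-lin : ∀ x y z → + (x ℕ.+ y ℕ.* z) ≡ + x + + y * + z
    pos-lin x y z = trans (pos-+ x (y ℕ.* z)) (cong (λ w → + x + w) (pos-* y z))
  shift : ∀ k a b n → k - a ≡ (k + b * n) - a - b * n
  shift = solve-∀
  collect : ∀ a t b n → (a + t * n) - a - b * n ≡ (t - b) * n
  collect = solve-∀

-- With M = 1 + L s and a the residue of A, the witness k = e M + a (M − 1)² + L M = e + L (1 + c)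
-- is ≡ a modulo M and ≡ e modulo L.
prescribe-residues : ∀ L s e A → ∃ λ c → + (e ℕ.+ L ℕ.* suc c) ≡ A [mod suc (L ℕ.* s) ]
prescribe-residues L s e A = c , mod-trans (k+bn≡a+tn⇒k≡a (2 ℕ.* a) t (identity L s e a)) (mod-sym A≡a)
  where
  M a c t : ℕ
  M = suc (L ℕ.* s)
  a = A %ℕ M
  c = e ℕ.* s ℕ.+ a ℕ.* L ℕ.* s ℕ.* s ℕ.+ L ℕ.* s
  t = e ℕ.+ a ℕ.* M ℕ.+ L
  A≡a : A ≡ + a [mod M ]
  A≡a = from-∣ (divides (A /ℕ M)
    (trans (cong (_- + a) (a≡a%ℕn+[a/ℕn]*n A M)) (cancel (+ a) (A /ℕ M * + M))))
    where
    cancel : ∀ u v → u + v - u ≡ v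
    cancel = solve-∀
  identity : ∀ L s e a →
    e ℕ.+ L ℕ.* suc (e ℕ.* s ℕ.+ a ℕ.* L ℕ.* s ℕ.* s ℕ.+ L ℕ.* s) ℕ.+ 2 ℕ.* a ℕ.* suc (L ℕ.* s)
      ≡ a ℕ.+ (e ℕ.+ a ℕ.* suc (L ℕ.* s) ℕ.+ L) ℕ.* suc (L ℕ.* s)
  identity = ℕ-Solver.solve-∀

even⊎odd : ∀ n → ∃ λ h → n ≡ h ℕ.+ h ⊎ n ≡ suc (h ℕ.+ h)
even⊎odd zero    = 0 , inj₁ refl
even⊎odd (suc n) with even⊎odd n
... | h , inj₁ n≡h+h   = h , inj₂ (cong suc n≡h+h)
... | h , inj₂ n≡1+h+h = suc h , inj₁ (cong suc (trans n≡1+h+h (sym (ℕ.+-suc h h))))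

prime⇒two⊎odd : ∀ {p} → Prime p → p ≡ 2 ⊎ ∃ λ h → p ≡ suc (suc h ℕ.+ suc h)
prime⇒two⊎odd {p} p-prime with even⊎odd p
... | zero  , inj₂ refl = ⊥-elim (¬prime[1] p-prime)
... | suc h , inj₂ refl = inj₂ (h , refl)
... | h     , inj₁ refl with prime⇒irreducible p-prime (ℕ.divides h (h+h≡h*2 h))
  where
  h+h≡h*2 : ∀ h → h ℕ.+ h ≡ h ℕ.* 2
  h+h≡h*2 = ℕ-Solver.solve-∀
...   | inj₂ 2≡p = inj₁ (sym 2≡p)

-- Primes and Fermat's little theorem

module _ {p : ℕ} (p-prime : Prime p) where

  private
    P : ℤ
    P = + p

  prime∣*⇒∣⊎∣ : ∀ x y → P ∣ x * y → P ∣ x ⊎ P ∣ y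
  prime∣*⇒∣⊎∣ x y d
    with euclidsLemma ℤ.∣ x ∣ ℤ.∣ y ∣ p-prime (subst (p ℕ.∣_) (abs-* x y) (∣⇒∣ᵤ d))
  ... | inj₁ p∣x = inj₁ (∣ᵤ⇒∣ p∣x)
  ... | inj₂ p∣y = inj₂ (∣ᵤ⇒∣ p∣y)

  prime∤1 : ¬ P ∣ 1ℤ
  prime∤1 d = ¬prime[1] (subst Prime (ℕ.∣1⇒≡1 (∣⇒∣ᵤ d)) p-prime)

  prime∣^⇒∣ : ∀ x e → P ∣ x ^ e → P ∣ x
  prime∣^⇒∣ x zero    d = ⊥-elim (prime∤1 d)
  prime∣^⇒∣ x (suc e) d with prime∣*⇒∣⊎∣ x (x ^ e) d
  ... | inj₁ p∣x  = p∣x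
  ... | inj₂ p∣xᵉ = prime∣^⇒∣ x e p∣xᵉ

  ∤*∤⇒∤ : ∀ {x y} → ¬ P ∣ x → ¬ P ∣ y → ¬ P ∣ x * y
  ∤*∤⇒∤ {x} {y} p∤x p∤y d with prime∣*⇒∣⊎∣ x y d
  ... | inj₁ p∣x = p∤x p∣x
  ... | inj₂ p∣y = p∤y p∣y

  ∤⇒∤^ : ∀ {x} e → ¬ P ∣ x → ¬ P ∣ x ^ e
  ∤⇒∤^ e p∤x = p∤x ∘ prime∣^⇒∣ _ e

[1+k]*[1+n]C[1+k]≡[1+n]*nCk : ∀ n k → suc k ℕ.* (suc n C suc k) ≡ suc n ℕ.* (n C k)
[1+k]*[1+n]C[1+k]≡[1+n]*nCk n       zero    = trans (ℕ.+-identityʳ _) (trans (nC1≡n (suc n)) (sym (ℕ.*-identityʳ _)))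
[1+k]*[1+n]C[1+k]≡[1+n]*nCk zero    (suc k) = ℕ.*-zeroʳ (suc (suc k))
[1+k]*[1+n]C[1+k]≡[1+n]*nCk (suc n) (suc k) = begin
  suc (suc k) ℕ.* (suc (suc n) C suc (suc k))
    ≡⟨ cong (suc (suc k) ℕ.*_) (sym (nCk+nC[k+1]≡[n+1]C[k+1] (suc n) (suc k))) ⟩
  suc (suc k) ℕ.* (a ℕ.+ b)
    ≡⟨ lemma (suc k) a b ⟩
  suc k ℕ.* a ℕ.+ suc (suc k) ℕ.* b ℕ.+ a
    ≡⟨ cong₂ (λ u v → u ℕ.+ v ℕ.+ a) ([1+k]*[1+n]C[1+k]≡[1+n]*nCk n k)
                                       ([1+k]*[1+n]C[1+k]≡[1+n]*nCk n (suc k)) ⟩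
  suc n ℕ.* (n C k) ℕ.+ suc n ℕ.* (n C suc k) ℕ.+ a
    ≡⟨ cong (ℕ._+ a) (sym (ℕ.*-distribˡ-+ (suc n) (n C k) (n C suc k))) ⟩
  suc n ℕ.* (n C k ℕ.+ n C suc k) ℕ.+ a
    ≡⟨ cong (λ u → suc n ℕ.* u ℕ.+ a) (nCk+nC[k+1]≡[n+1]C[k+1] n k) ⟩
  suc n ℕ.* a ℕ.+ a
    ≡⟨ ℕ.+-comm (suc n ℕ.* a) a ⟩
  suc (suc n) ℕ.* a ∎
  where
  open ≡-Reasoning
  a b : ℕ
  a = suc n C suc k
  b = suc n C suc (suc k)
  lemma : ∀ k a b → suc k ℕ.* (a ℕ.+ b) ≡ k ℕ.* a ℕ.+ suc k ℕ.* b ℕ.+ a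
  lemma = ℕ-Solver.solve-∀

prime∣pC[1+k] : ∀ {p} → Prime p → ∀ k → suc k ℕ.< p → p ℕ.∣ p C suc k
prime∣pC[1+k] {suc p} p-prime k 1+k<p
  with euclidsLemma (suc k) (suc p C suc k) p-prime
         (ℕ.divides (p C k) (trans ([1+k]*[1+n]C[1+k]≡[1+n]*nCk p k) (ℕ.*-comm (suc p) (p C k))))
... | inj₁ p∣1+k = ⊥-elim (ℕ.<⇒≱ 1+k<p (ℕ.∣⇒≤ p∣1+k))
... | inj₂ p∣pC1+k = p∣pC1+k

×ₛ≡* : ∀ c x → c ×ₛ x ≡ + c * x
×ₛ≡* zero    x = sym (*-zeroˡ x)
×ₛ≡* (suc c) x = trans (cong (λ z → x + z) (×ₛ≡* c x)) (sym (suc-* (+ c) x))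

∣-sum : ∀ {d n} (t : Vector ℤ n) → (∀ i → d ∣ t i) → d ∣ sum t
∣-sum {d} {zero} t d∣t = divides 0ℤ (sym (*-zeroˡ d))
∣-sum {n = suc n} t d∣t = ∣m∣n⇒∣m+n (d∣t Fin.zero) (∣-sum (tail t) (d∣t ∘ Fin.suc))

binomialTerm≡ : ∀ x y n (i : Fin (suc n)) →
  binomialTerm x y n i ≡ + (n C toℕ i) * (x ^ toℕ i * y ^ (n ∸ toℕ i))
binomialTerm≡ x y n i =
  trans (×ₛ≡* (n C toℕ i) _)
        (cong₂ (λ u v → + (n C toℕ i) * (u * v)) (^ₛ≡^ x (toℕ i)) (^ₛ≡^ y (n ∸ toℕ i)))

frobenius : ∀ {p} → Prime p → ∀ x y → (x + y) ^ p ≡ x ^ p + y ^ p [mod p ]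
frobenius {zero}  p-prime = ⊥-elim (¬prime[0] p-prime)
frobenius {suc p} p-prime x y = from-∣ (subst (+ suc p ∣_) (sym difference) (∣-sum middle p∣middle))
  where
  t : Vector ℤ (suc (suc p))
  t = binomialTerm x y (suc p)
  middle : Vector ℤ p
  middle = init (tail t)
  first≡ : t Fin.zero ≡ y ^ suc p
  first≡ = trans (binomialTerm≡ x y (suc p) Fin.zero) (trans (*-identityˡ _) (*-identityˡ _))
  last≡ : last (tail t) ≡ x ^ suc p
  last≡ = begin
    last (tail t)
      ≡⟨ binomialTerm≡ x y (suc p) (Fin.suc (fromℕ p)) ⟩
    + (suc p C suc k) * (x ^ suc k * y ^ (p ∸ k))
      ≡⟨ cong (λ k → + (suc p C suc k) * (x ^ suc k * y ^ (p ∸ k))) (toℕ-fromℕ p) ⟩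
    + (suc p C suc p) * (x ^ suc p * y ^ (p ∸ p))
      ≡⟨ cong₂ (λ c e → + c * (x ^ suc p * y ^ e)) (nCn≡1 (suc p)) (ℕ.n∸n≡0 p) ⟩
    1ℤ * (x ^ suc p * 1ℤ)
      ≡⟨ trans (*-identityˡ _) (*-identityʳ _) ⟩
    x ^ suc p ∎
    where
    open ≡-Reasoning
    k : ℕ
    k = toℕ (fromℕ p)
  p∣middle : ∀ i → + suc p ∣ middle i
  p∣middle i = subst (+ suc p ∣_) (sym (binomialTerm≡ x y (suc p) (Fin.suc (inject₁ i))))
    (∣m⇒∣m*n (x ^ suc k * y ^ (p ∸ k)) (∣ᵤ⇒∣ {i = + (suc p C suc k)} (prime∣pC[1+k] p-prime k
      (ℕ.s≤s (subst (ℕ._< p) (sym (toℕ-inject₁ i)) (toℕ<n i))))))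
    where
    k : ℕ
    k = toℕ (inject₁ i)
  expansion : (x + y) ^ suc p ≡ y ^ suc p + (sum middle + x ^ suc p)
  expansion = begin
    (x + y) ^ suc p        ≡⟨ sym (^ₛ≡^ (x + y) (suc p)) ⟩
    (x + y) ^ₛ suc p       ≡⟨ binomial-theorem (suc p) x y ⟩
    t Fin.zero + sum (tail t) ≡⟨ cong₂ _+_ first≡ (sum-init-last (tail t)) ⟩
    y ^ suc p + (sum middle + last (tail t)) ≡⟨ cong (λ z → y ^ suc p + (sum middle + z)) last≡ ⟩
    y ^ suc p + (sum middle + x ^ suc p) ∎
    where open ≡-Reasoning
  difference : (x + y) ^ suc p - (x ^ suc p + y ^ suc p) ≡ sum middle
  difference = trans (cong (_- (x ^ suc p + y ^ suc p)) expansion) (cancel (y ^ suc p) (sum middle) (x ^ suc p))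
    where
    cancel : ∀ a m b → a + (m + b) - (b + a) ≡ m
    cancel = solve-∀

fermat : ∀ {p} → Prime p → ∀ x → x ^ p ≡ x [mod p ]
fermat {zero}  p-prime = ⊥-elim (¬prime[0] p-prime)
fermat {suc p} p-prime = fermat-ℤ
  where
  open import Relation.Binary.Reasoning.Setoid (mod-setoid {suc p})
  fermat-ℕ : ∀ a → (+ a) ^ suc p ≡ + a [mod suc p ]
  fermat-ℕ zero    = mod-reflexive (0^[1+n]≡0 p)
  fermat-ℕ (suc a) = begin
    (1ℤ + + a) ^ suc p        ≈⟨ frobenius p-prime 1ℤ (+ a) ⟩
    1ℤ ^ suc p + (+ a) ^ suc p ≈⟨ +-cong-mod (mod-reflexive (^-zeroˡ (suc p))) (fermat-ℕ a) ⟩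
    1ℤ + + a ∎
  fermat-ℤ : ∀ x → x ^ suc p ≡ x [mod suc p ]
  fermat-ℤ (+ a)      = fermat-ℕ a
  fermat-ℤ -[1+ a ]   = begin
    x ^ suc p                                 ≡⟨ split (x ^ suc p) (y ^ suc p) ⟩
    (x ^ suc p + y ^ suc p) - y ^ suc p
      ≈⟨ +-cong-mod (mod-sym (frobenius p-prime x y)) (-‿cong-mod (fermat-ℕ (suc a))) ⟩
    (x + y) ^ suc p - y                        ≡⟨ cong (λ z → z ^ suc p - y) (-y+y≡0 y) ⟩
    0ℤ ^ suc p - y                             ≡⟨ cong (_- y) (0^[1+n]≡0 p) ⟩
    0ℤ - y                                     ≡⟨ 0-y≡-y y ⟩
    x ∎
    where
    x y : ℤ
    y = + suc a
    x = - y
    split : ∀ u v → u ≡ (u + v) - v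
    split = solve-∀
    -y+y≡0 : ∀ y → - y + y ≡ 0ℤ
    -y+y≡0 = solve-∀
    0-y≡-y : ∀ y → 0ℤ - y ≡ - y
    0-y≡-y = solve-∀

fermat-unit : ∀ {p} → Prime p → ∀ {x} → ¬ + p ∣ x → x ^ (p ∸ 1) ≡ 1ℤ [mod p ]
fermat-unit {zero}  p-prime = ⊥-elim (¬prime[0] p-prime)
fermat-unit {suc r} p-prime {x} p∤x =
  [ ⊥-elim ∘ p∤x , from-∣ ]′ (prime∣*⇒∣⊎∣ p-prime x (x ^ r - 1ℤ) p∣x[xʳ-1])
  where
  factor : ∀ x u → x * u - x ≡ x * (u - 1ℤ)
  factor = solve-∀
  p∣x[xʳ-1] : + suc r ∣ x * (x ^ r - 1ℤ)
  p∣x[xʳ-1] = subst (+ suc r ∣_) (factor x (x ^ r)) (to-∣ (fermat p-prime x))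

-- Modulo p²

module _ {n : ℕ} where

  private
    N : ℤ
    N = + n

  *-∣-square : ∀ {a b} → N ∣ a → N ∣ b → + (n ℕ.* n) ∣ a * b
  *-∣-square {a} {b} n∣a n∣b =
    subst (_∣ a * b) (sym (pos-* n n)) (∣-trans (*-monoʳ-∣ N n∣b) (*-monoˡ-∣ b n∣a))

  near-one-product : ∀ {a b} → N ∣ a → N ∣ b → (1ℤ + a) * (1ℤ + b) ≡ 1ℤ + (a + b) [mod n ℕ.* n ]
  near-one-product {a} {b} n∣a n∣b = from-∣ (subst (+ (n ℕ.* n) ∣_) (expand a b) (*-∣-square n∣a n∣b))
    where
    expand : ∀ a b → a * b ≡ (1ℤ + a) * (1ℤ + b) - (1ℤ + (a + b))
    expand = solve-∀

  near-one-power : ∀ {w} → N ∣ w → ∀ e → (1ℤ + w) ^ e ≡ 1ℤ + + e * w [mod n ℕ.* n ]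
  near-one-power {w} n∣w zero    = mod-reflexive (one w)
    where
    one : ∀ w → 1ℤ ≡ 1ℤ + 0ℤ * w
    one = solve-∀
  near-one-power {w} n∣w (suc e) = begin
    (1ℤ + w) * (1ℤ + w) ^ e    ≈⟨ *-congˡ-mod (1ℤ + w) (near-one-power n∣w e) ⟩
    (1ℤ + w) * (1ℤ + + e * w)  ≈⟨ near-one-product n∣w (∣n⇒∣m*n (+ e) n∣w) ⟩
    1ℤ + (w + + e * w)         ≡⟨ cong (λ z → 1ℤ + z) (sym (suc-* (+ e) w)) ⟩
    1ℤ + + suc e * w ∎
    where open import Relation.Binary.Reasoning.Setoid (mod-setoid {n ℕ.* n})

fermat-unit-power : ∀ {p} → Prime p → ∀ {x} → ¬ + p ∣ x → ∀ e →
  (x ^ (p ∸ 1)) ^ e ≡ 1ℤ + + e * (x ^ (p ∸ 1) - 1ℤ) [mod p ℕ.* p ]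
fermat-unit-power {p} p-prime {x} p∤x e =
  mod-trans (mod-reflexive (cong (_^ e) (split (x ^ (p ∸ 1))))) (near-one-power (to-∣ (fermat-unit p-prime p∤x)) e)
  where
  split : ∀ u → u ≡ 1ℤ + (u - 1ℤ)
  split = solve-∀

euler-p² : ∀ {p} → Prime p → ∀ {x} → ¬ + p ∣ x → (x ^ (p ∸ 1)) ^ p ≡ 1ℤ [mod p ℕ.* p ]
euler-p² {p} p-prime {x} p∤x = begin
  (x ^ (p ∸ 1)) ^ p                 ≈⟨ fermat-unit-power p-prime p∤x p ⟩
  1ℤ + + p * (x ^ (p ∸ 1) - 1ℤ)     ≈⟨ +-cong-mod (mod-refl {x = 1ℤ}) (∣⇒≡0-mod (*-∣-square ∣-refl p∣xʳ-1)) ⟩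
  1ℤ + 0ℤ                           ≡⟨ +-identityʳ 1ℤ ⟩
  1ℤ ∎
  where
  open import Relation.Binary.Reasoning.Setoid (mod-setoid {p ℕ.* p})
  p∣xʳ-1 : + p ∣ x ^ (p ∸ 1) - 1ℤ
  p∣xʳ-1 = to-∣ (fermat-unit p-prime p∤x)

inverse-mod-p² : ∀ {p} → Prime p → ∀ {x} → ¬ + p ∣ x → ∃ λ y → x * y ≡ 1ℤ [mod p ℕ.* p ]
inverse-mod-p² {zero}        p-prime = ⊥-elim (¬prime[0] p-prime)
inverse-mod-p² {suc zero}    p-prime = ⊥-elim (¬prime[1] p-prime)
inverse-mod-p² {suc (suc r)} p-prime {x} p∤x =
  x ^ r * (x ^ suc r) ^ suc r ,
  mod-trans (mod-reflexive (sym (*-assoc x (x ^ r) ((x ^ suc r) ^ suc r)))) (euler-p² p-prime p∤x)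

p²∣*⇒p²∣ : ∀ {p} → Prime p → ∀ {u v} → ¬ + p ∣ u → + (p ℕ.* p) ∣ u * v → + (p ℕ.* p) ∣ v
p²∣*⇒p²∣ {p} p-prime {u} {v} p∤u p²∣uv with inverse-mod-p² p-prime p∤u
... | i , ui≡1 = ≡0-mod⇒∣ (begin
  v              ≡⟨ sym (*-identityˡ v) ⟩
  1ℤ * v         ≈⟨ *-congʳ-mod v (mod-sym ui≡1) ⟩
  u * i * v      ≡⟨ swap u i v ⟩
  i * (u * v)    ≈⟨ *-congˡ-mod i (∣⇒≡0-mod p²∣uv) ⟩
  i * 0ℤ         ≡⟨ *-zeroʳ i ⟩
  0ℤ ∎)
  where
  open import Relation.Binary.Reasoning.Setoid (mod-setoid {p ℕ.* p})
  swap : ∀ u i v → u * i * v ≡ i * (u * v)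
  swap = solve-∀

unit-mod-p²⇒∤ : ∀ {p} → Prime p → ∀ {x y} → x * y ≡ 1ℤ [mod p ℕ.* p ] → ¬ + p ∣ x
unit-mod-p²⇒∤ {p} p-prime {x} {y} xy≡1 p∣x =
  prime∤1 p-prime (∣-resp-mod (mod-weaken (ℕ.m∣m*n p) xy≡1) (∣m⇒∣m*n y p∣x))

-- Solutions of p² ∣ D_ε(n, m)

⟦_⟧ : Sign → ℤ
⟦ plus  ⟧ = 1ℤ
⟦ minus ⟧ = -1ℤ

-⟦ε⟧*-⟦ε⟧≡1 : ∀ ε → - ⟦ ε ⟧ * - ⟦ ε ⟧ ≡ 1ℤ
-⟦ε⟧*-⟦ε⟧≡1 plus  = refl
-⟦ε⟧*-⟦ε⟧≡1 minus = refl

D[k+m,m]≡ : ∀ ε k m → D ε (k ℕ.+ m) m ≡ (+ (k ℕ.+ m)) ^ (k ℕ.+ m) - (- ⟦ ε ⟧) * ((+ k) ^ k * (+ m) ^ m)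
D[k+m,m]≡ plus k m rewrite ℕ.m+n∸n≡m k m = plus≡ ((+ (k ℕ.+ m)) ^ (k ℕ.+ m)) ((+ k) ^ k * (+ m) ^ m)
  where
  plus≡ : ∀ a b → a + b ≡ a - - 1ℤ * b
  plus≡ = solve-∀
D[k+m,m]≡ minus k m rewrite ℕ.m+n∸n≡m k m = minus≡ ((+ (k ℕ.+ m)) ^ (k ℕ.+ m)) ((+ k) ^ k * (+ m) ^ m)
  where
  minus≡ : ∀ a b → a - b ≡ a - - -1ℤ * b
  minus≡ = solve-∀

record Solution (ε : Sign) (p k m : ℕ) : Set where
  field
    k>0        : 0 ℕ.< k
    m>0        : 0 ℕ.< m
    p∤m        : ¬ + p ∣ + m
    congruence : (+ (k ℕ.+ m)) ^ (k ℕ.+ m) ≡ - ⟦ ε ⟧ * ((+ k) ^ k * (+ m) ^ m) [mod p ℕ.* p ]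

InP⇒Solution : ∀ {ε p} → InP ε p → ∃ λ k → ∃ λ m → Solution ε p k m
InP⇒Solution {ε} {p} (_ , n , m , m>0 , m<n , p∤m , p²∣D) = n ∸ m , m , record
  { k>0        = ℕ.m<n⇒0<n∸m m<n
  ; m>0        = m>0
  ; p∤m        = p∤m ∘ ∣⇒∣ᵤ
  ; congruence = from-∣ (subst (+ (p ℕ.* p) ∣_) (D[k+m,m]≡ ε (n ∸ m) m) p²∣D′)
  }
  where
  p²∣D′ : + (p ℕ.* p) ∣ D ε (n ∸ m ℕ.+ m) m
  p²∣D′ = subst (λ n → + (p ℕ.* p) ∣ D ε n m) (sym (ℕ.m∸n+n≡m (ℕ.<⇒≤ m<n))) (∣ᵤ⇒∣ p²∣D)

Solution⇒InP : ∀ {ε p} → Prime p → (∃ λ k → ∃ λ m → Solution ε p k m) → InP ε p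
Solution⇒InP {ε} {p} p-prime (k , m , s) = p-prime , k ℕ.+ m , m , m>0 , ℕ.m<n+m m k>0 , p∤m ∘ ∣ᵤ⇒∣ ,
  ∣⇒∣ᵤ (subst (+ (p ℕ.* p) ∣_) (sym (D[k+m,m]≡ ε k m)) (to-∣ congruence))
  where open Solution s

-⟦ε⟧-involutive : ∀ ε x → - ⟦ ε ⟧ * (- ⟦ ε ⟧ * x) ≡ x
-⟦ε⟧-involutive ε x = begin
  - ⟦ ε ⟧ * (- ⟦ ε ⟧ * x)   ≡⟨ sym (*-assoc (- ⟦ ε ⟧) (- ⟦ ε ⟧) x) ⟩
  - ⟦ ε ⟧ * - ⟦ ε ⟧ * x     ≡⟨ cong (_* x) (-⟦ε⟧*-⟦ε⟧≡1 ε) ⟩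
  1ℤ * x                    ≡⟨ *-identityˡ x ⟩
  x ∎
  where open ≡-Reasoning

solution⇒coprime : ∀ {ε p k m} → Prime p → Solution ε p k m → ¬ + p ∣ + (k ℕ.+ m) × ¬ + p ∣ + k
solution⇒coprime {ε} {p} {k} {m} p-prime s = p∤n , p∤k
  where
  open Solution s
  P N K M Q σ : ℤ
  P = + p
  N = + (k ℕ.+ m)
  K = + k
  M = + m
  Q = K ^ k * M ^ m
  σ = - ⟦ ε ⟧
  congruence-mod-p : N ^ (k ℕ.+ m) ≡ σ * Q [mod p ]
  congruence-mod-p = mod-weaken (ℕ.m∣m*n p) congruence
  p∣n⇒p∣Q : P ∣ N → P ∣ Q
  p∣n⇒p∣Q p∣n = subst (P ∣_) (-⟦ε⟧-involutive ε Q)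
    (∣n⇒∣m*n σ (∣-resp-mod congruence-mod-p (∣⇒∣^ p∣n (ℕ.<-≤-trans k>0 (ℕ.m≤m+n k m)))))
  p∤k : ¬ P ∣ K
  p∤k p∣k = p∤m (subst (P ∣_) n-k≡m (∣m∣n⇒∣m-n p∣n p∣k))
    where
    p∣n : P ∣ N
    p∣n = prime∣^⇒∣ p-prime N (k ℕ.+ m)
      (∣-resp-mod (mod-sym congruence-mod-p) (∣n⇒∣m*n σ (∣m⇒∣m*n (M ^ m) (∣⇒∣^ p∣k k>0))))
    n-k≡m : N - K ≡ M
    n-k≡m = trans (cong (_- K) (pos-+ k m)) (cancel K M)
      where
      cancel : ∀ a b → a + b - a ≡ b
      cancel = solve-∀
  p∤n : ¬ P ∣ N
  p∤n p∣n = [ p∤k ∘ prime∣^⇒∣ p-prime K k , p∤m ∘ prime∣^⇒∣ p-prime M m ]′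
                (prime∣*⇒∣⊎∣ p-prime (K ^ k) (M ^ m) (p∣n⇒p∣Q p∣n))

sum-of-pth-powers : ∀ {p} → Prime p → ∀ {k m} → ¬ + p ∣ + (k ℕ.+ m) → ¬ + p ∣ + k → ¬ + p ∣ + m →
  ((+ (k ℕ.+ m)) ^ (k ℕ.+ m)) ^ (p ∸ 1) ≡ ((+ k) ^ k * (+ m) ^ m) ^ (p ∸ 1) [mod p ℕ.* p ] →
  (+ (k ℕ.+ m)) ^ p ≡ (+ k) ^ p + (+ m) ^ p [mod p ℕ.* p ]
sum-of-pth-powers {zero}  p-prime = ⊥-elim (¬prime[0] p-prime)
sum-of-pth-powers {suc r} p-prime {k} {m} p∤n p∤k p∤m hyp = begin
  N ^ suc r                  ≡⟨ unfold N (N ^ r) ⟩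
  N + N * W N                ≈⟨ +-cong-mod (mod-refl {x = N}) linear-terms ⟩
  N + (K * W K + M * W M)    ≡⟨ cong (λ z → z + (K * W K + M * W M)) (pos-+ k m) ⟩
  K + M + (K * W K + M * W M) ≡⟨ refold K M (K ^ r) (M ^ r) ⟩
  K ^ suc r + M ^ suc r ∎
  where
  open import Relation.Binary.Reasoning.Setoid (mod-setoid {suc r ℕ.* suc r})
  N K M : ℤ
  N = + (k ℕ.+ m)
  K = + k
  M = + m
  W : ℤ → ℤ
  W z = z ^ r - 1ℤ
  unfold : ∀ z u → z * u ≡ z + z * (u - 1ℤ)
  unfold = solve-∀
  refold : ∀ a b u v → a + b + (a * (u - 1ℤ) + b * (v - 1ℤ)) ≡ a * u + b * v
  refold = solve-∀
  linearise : ∀ {z} → ¬ + suc r ∣ + z → ((+ z) ^ z) ^ r ≡ 1ℤ + + z * W (+ z) [mod suc r ℕ.* suc r ]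
  linearise {z} p∤z = mod-trans (mod-reflexive (^-comm-exponents (+ z) z r)) (fermat-unit-power p-prime p∤z z)
  p∣zW : ∀ {z} → ¬ + suc r ∣ + z → + suc r ∣ + z * W (+ z)
  p∣zW {z} p∤z = ∣n⇒∣m*n (+ z) (to-∣ (fermat-unit p-prime p∤z))
  linear-terms : N * W N ≡ K * W K + M * W M [mod suc r ℕ.* suc r ]
  linear-terms = begin
    N * W N                                   ≡⟨ sym (add-sub-one (N * W N)) ⟩
    1ℤ + N * W N - 1ℤ                         ≈⟨ +-cong-mod (mod-sym (linearise p∤n)) mod-refl ⟩
    (N ^ (k ℕ.+ m)) ^ r - 1ℤ                  ≈⟨ +-cong-mod hyp mod-refl ⟩
    (K ^ k * M ^ m) ^ r - 1ℤ                  ≡⟨ cong (_- 1ℤ) (^-distribʳ-* (K ^ k) (M ^ m) r) ⟩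
    (K ^ k) ^ r * (M ^ m) ^ r - 1ℤ            ≈⟨ +-cong-mod (*-cong-mod (linearise p∤k) (linearise p∤m)) mod-refl ⟩
    (1ℤ + K * W K) * (1ℤ + M * W M) - 1ℤ      ≈⟨ +-cong-mod (near-one-product (p∣zW p∤k) (p∣zW p∤m)) mod-refl ⟩
    1ℤ + (K * W K + M * W M) - 1ℤ             ≡⟨ add-sub-one (K * W K + M * W M) ⟩
    K * W K + M * W M ∎
    where
    add-sub-one : ∀ a → 1ℤ + a - 1ℤ ≡ a
    add-sub-one = solve-∀

-- The prime 2

odd≡1-mod-2 : ∀ {x} → ¬ + 2 ∣ x → x ≡ 1ℤ [mod 2 ]
odd≡1-mod-2 {x} 2∤x = mod-trans (mod-reflexive (sym (*-identityʳ x))) (fermat-unit prime[2] 2∤x)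

no-solution-mod-4 : ∀ {ε k m} → ¬ Solution ε 2 k m
no-solution-mod-4 {ε} {k} {m} s = 2∤n (subst (+ 2 ∣_) (sym (pos-+ k m)) (≡0-mod⇒∣ odd+odd≡0))
  where
  2∤n : ¬ + 2 ∣ + (k ℕ.+ m)
  2∤n = proj₁ (solution⇒coprime prime[2] s)
  2∤k : ¬ + 2 ∣ + k
  2∤k = proj₂ (solution⇒coprime prime[2] s)
  odd+odd≡0 : + k + + m ≡ 0ℤ [mod 2 ]
  odd+odd≡0 = mod-trans (+-cong-mod (odd≡1-mod-2 2∤k) (odd≡1-mod-2 (Solution.p∤m s))) (∣⇒≡0-mod ∣-refl)

two∉InP : ∀ ε → ¬ InP ε 2
two∉InP ε inP = no-solution-mod-4 (proj₂ (proj₂ (InP⇒Solution {ε} inP)))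

two∉InCons : ¬ InCons 2
two∉InCons (_ , x , y , (_ , 2∤x) , (_ , 2∤y) , y-x≡±1) =
  [ (λ y-x≡1  → prime∤1 prime[2] (2∣ y-x≡1))
  , (λ y-x≡-1 → prime∤1 prime[2] (∣-neg {x = 1ℤ} (2∣ y-x≡-1)))
  ]′ y-x≡±1
  where
  y-x≡0 : y - x ≡ 0ℤ [mod 2 ]
  y-x≡0 = +-cong-mod {y = 1ℤ} {v = -1ℤ}
    (odd≡1-mod-2 {y} (2∤y ∘ ∣⇒∣ᵤ)) (-‿cong-mod (odd≡1-mod-2 {x} (2∤x ∘ ∣⇒∣ᵤ)))
  2∣ : ∀ {s} → (y - x) ≡[mod 2 ℕ.* 2 ] s → + 2 ∣ s
  2∣ y-x≡s = ≡0-mod⇒∣ (mod-trans (mod-sym (mod-weaken (ℕ.m∣m*n 2) (≡[mod]⇒≡-mod y-x≡s))) y-x≡0)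

-- Odd primes

-- p = 2h + 3, written so that r = p − 1 is even and positive by definition.
module OddPrime (h : ℕ) where

  r p : ℕ
  r = suc h ℕ.+ suc h
  p = suc r

  -⟦ε⟧^r≡1 : ∀ ε → (- ⟦ ε ⟧) ^ r ≡ 1ℤ
  -⟦ε⟧^r≡1 plus  = trans (-‿^-even 1ℤ (suc h)) (^-zeroˡ r)
  -⟦ε⟧^r≡1 minus = ^-zeroˡ r

  2<p : 2 ℕ.< p
  2<p = ℕ.s≤s (ℕ.s≤s (ℕ.<-≤-trans ℕ.z<s (ℕ.m≤n+m (suc h) h)))

  RootOfUnity : ℤ → Set
  RootOfUnity z = z ^ r ≡ 1ℤ [mod p ℕ.* p ]

  -‿root : ∀ {z} → RootOfUnity z → RootOfUnity (- z)
  -‿root {z} = mod-trans (mod-reflexive (-‿^-even z (suc h)))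

  record SplitOne : Set where
    field
      A B    : ℤ
      A-root : RootOfUnity A
      B-root : RootOfUnity B
      A+B≡1  : A + B ≡ 1ℤ [mod p ℕ.* p ]
  open SplitOne

  MinusOneReachable : Set
  MinusOneReachable = ∃ λ S → ∃ λ e₁ → ∃ λ e₂ → A S ^ e₁ * B S ^ e₂ ≡ -1ℤ [mod p ℕ.* p ]

  residue : ∀ e Z → ∃ λ c → + (e ℕ.+ r ℕ.* suc c) ≡ Z [mod p ℕ.* p ]
  residue e Z = subst (λ n → ∃ λ c → + (e ℕ.+ r ℕ.* suc c) ≡ Z [mod n ]) (modulus r)
                      (prescribe-residues r (suc (suc r)) e Z)
    where
    modulus : ∀ r → suc (r ℕ.* suc (suc r)) ≡ suc r ℕ.* suc r
    modulus = ℕ-Solver.solve-∀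

  OddPower MinusOnePower : ℤ → Set
  OddPower z      = ∃ λ o → z ^ suc (o ℕ.+ o) ≡ 1ℤ [mod p ℕ.* p ]
  MinusOnePower z = ∃ λ j → z ^ j ≡ -1ℤ [mod p ℕ.* p ]

  module _ (p-prime : Prime p) where

    sum-of-pth-powers⇒InCons : ∀ {N K M} → ¬ + p ∣ N → ¬ + p ∣ K → ¬ + p ∣ M →
                               N ^ p ≡ K ^ p + M ^ p [mod p ℕ.* p ] → InCons p
    sum-of-pth-powers⇒InCons {N} {K} {M} p∤N p∤K p∤M sum =
      p-prime , x , y ,
      ((a , ≡-mod⇒≡[mod] (mod-refl {x = x})) , p∤x ∘ ∣ᵤ⇒∣) ,
      ((b , ≡-mod⇒≡[mod] (mod-refl {x = y})) , p∤y ∘ ∣ᵤ⇒∣) ,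
      inj₁ (≡-mod⇒≡[mod] y-x≡1)
      where
      open import Relation.Binary.Reasoning.Setoid (mod-setoid {p ℕ.* p})
      I : ℤ
      I = proj₁ (inverse-mod-p² p-prime p∤N)
      NI≡1 : N * I ≡ 1ℤ [mod p ℕ.* p ]
      NI≡1 = proj₂ (inverse-mod-p² p-prime p∤N)
      a b x y : ℤ
      a = - (M * I)
      b = K * I
      x = a ^ p
      y = b ^ p
      p∤I : ¬ + p ∣ I
      p∤I = unit-mod-p²⇒∤ p-prime (mod-trans (mod-reflexive (*-comm I N)) NI≡1)
      p∤x : ¬ + p ∣ x
      p∤x = ∤⇒∤^ p-prime p (∤*∤⇒∤ p-prime p∤M p∤I ∘ ∣-neg)
      p∤y : ¬ + p ∣ y
      p∤y = ∤⇒∤^ p-prime p (∤*∤⇒∤ p-prime p∤K p∤I)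
      y-x≡1 : y - x ≡ 1ℤ [mod p ℕ.* p ]
      y-x≡1 = begin
        (K * I) ^ p - (- (M * I)) ^ p       ≡⟨ cong (λ z → (K * I) ^ p - z) (-‿^-odd (M * I) (suc h)) ⟩
        (K * I) ^ p - - (M * I) ^ p         ≡⟨ cong₂ (λ u v → u - - v) (^-distribʳ-* K I p) (^-distribʳ-* M I p) ⟩
        K ^ p * I ^ p - - (M ^ p * I ^ p)   ≡⟨ factor (K ^ p) (M ^ p) (I ^ p) ⟩
        (K ^ p + M ^ p) * I ^ p             ≈⟨ *-congʳ-mod (I ^ p) (mod-sym sum) ⟩
        N ^ p * I ^ p                       ≡⟨ sym (^-distribʳ-* N I p) ⟩
        (N * I) ^ p                         ≈⟨ ^-congˡ-mod p NI≡1 ⟩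
        1ℤ ^ p                              ≡⟨ ^-zeroˡ p ⟩
        1ℤ ∎
        where
        factor : ∀ u v w → u * w - - (v * w) ≡ (u + v) * w
        factor = solve-∀

    solution⇒InCons : ∀ {ε k m} → Solution ε p k m → InCons p
    solution⇒InCons {ε} {k} {m} s =
      sum-of-pth-powers⇒InCons p∤n p∤k p∤m (sum-of-pth-powers p-prime p∤n p∤k p∤m raised)
      where
      open Solution s
      open import Relation.Binary.Reasoning.Setoid (mod-setoid {p ℕ.* p})
      p∤n : ¬ + p ∣ + (k ℕ.+ m)
      p∤n = proj₁ (solution⇒coprime p-prime s)
      p∤k : ¬ + p ∣ + k
      p∤k = proj₂ (solution⇒coprime p-prime s)
      Q : ℤ
      Q = (+ k) ^ k * (+ m) ^ m
      raised : ((+ (k ℕ.+ m)) ^ (k ℕ.+ m)) ^ r ≡ Q ^ r [mod p ℕ.* p ]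
      raised = begin
        ((+ (k ℕ.+ m)) ^ (k ℕ.+ m)) ^ r    ≈⟨ ^-congˡ-mod r congruence ⟩
        (- ⟦ ε ⟧ * Q) ^ r                  ≡⟨ ^-distribʳ-* (- ⟦ ε ⟧) Q r ⟩
        (- ⟦ ε ⟧) ^ r * Q ^ r              ≡⟨ cong (_* Q ^ r) (-⟦ε⟧^r≡1 ε) ⟩
        1ℤ * Q ^ r                         ≡⟨ *-identityˡ (Q ^ r) ⟩
        Q ^ r ∎

    InP⇒InCons : ∀ {ε} → InP ε p → InCons p
    InP⇒InCons {ε} inP = solution⇒InCons (proj₂ (proj₂ (InP⇒Solution {ε} inP)))

    pth-power⇒root : ∀ {x} → NonzeroPthPowerMod p x → RootOfUnity x
    pth-power⇒root {x} ((a , x≡[mod]aᵖ) , p∤x) = begin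
      x ^ r          ≈⟨ ^-congˡ-mod r x≡aᵖ ⟩
      (a ^ p) ^ r    ≡⟨ ^-comm-exponents a p r ⟩
      (a ^ r) ^ p    ≈⟨ euler-p² p-prime p∤a ⟩
      1ℤ ∎
      where
      open import Relation.Binary.Reasoning.Setoid (mod-setoid {p ℕ.* p})
      x≡aᵖ : x ≡ a ^ p [mod p ℕ.* p ]
      x≡aᵖ = ≡[mod]⇒≡-mod {x = x} {y = a ^ p} x≡[mod]aᵖ
      p∤a : ¬ + p ∣ a
      p∤a p∣a = p∤x (∣⇒∣ᵤ (∣-resp-mod (mod-sym (mod-weaken (ℕ.m∣m*n p) x≡aᵖ))
                                      (∣⇒∣^ p∣a {p} ℕ.z<s)))

    root⇒∤ : ∀ {z} → RootOfUnity z → ¬ + p ∣ z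
    root⇒∤ {z} = unit-mod-p²⇒∤ p-prime {z} {z ^ (h ℕ.+ suc h)}

    InCons⇒SplitOne : InCons p → SplitOne
    InCons⇒SplitOne (_ , x , y , x-power , y-power , inj₁ y-x≡1) = record
      { A = y ; B = - x
      ; A-root = pth-power⇒root {y} y-power
      ; B-root = -‿root {x} (pth-power⇒root {x} x-power)
      ; A+B≡1  = ≡[mod]⇒≡-mod y-x≡1
      }
    InCons⇒SplitOne (_ , x , y , x-power , y-power , inj₂ y-x≡-1) = record
      { A = x ; B = - y
      ; A-root = pth-power⇒root {x} x-power
      ; B-root = -‿root {y} (pth-power⇒root {y} y-power)
      ; A+B≡1  = mod-trans (mod-reflexive (negate x y))
                           (-‿cong-mod {x = y - x} {y = - 1ℤ} (≡[mod]⇒≡-mod y-x≡-1))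
      }
      where
      negate : ∀ x y → x + - y ≡ - (y - x)
      negate = solve-∀

    realise : ∀ ε (S : SplitOne) e₁ e₂ → A S ^ e₁ * B S ^ e₂ ≡ - ⟦ ε ⟧ [mod p ℕ.* p ] →
              ∃ λ k → ∃ λ m → Solution ε p k m
    realise ε S e₁ e₂ target = k , m , record
      { k>0        = positive e₁ c₁
      ; m>0        = positive e₂ c₂
      ; p∤m        = λ p∣m → root⇒∤ {B S} (B-root S) (∣-resp-mod (mod-weaken (ℕ.m∣m*n p) m≡B) p∣m)
      ; congruence = begin
          (+ (k ℕ.+ m)) ^ (k ℕ.+ m)     ≡⟨ cong (_^ (k ℕ.+ m)) (pos-+ k m) ⟩
          (+ k + + m) ^ (k ℕ.+ m)       ≈⟨ ^-congˡ-mod (k ℕ.+ m) (mod-trans (+-cong-mod k≡A m≡B) (A+B≡1 S)) ⟩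
          1ℤ ^ (k ℕ.+ m)                ≡⟨ ^-zeroˡ (k ℕ.+ m) ⟩
          1ℤ                            ≡⟨ sym (-⟦ε⟧*-⟦ε⟧≡1 ε) ⟩
          - ⟦ ε ⟧ * - ⟦ ε ⟧             ≈⟨ *-congˡ-mod (- ⟦ ε ⟧) (mod-sym Kᵏ*Mᵐ≡target) ⟩
          - ⟦ ε ⟧ * ((+ k) ^ k * (+ m) ^ m) ∎
      }
      where
      open import Relation.Binary.Reasoning.Setoid (mod-setoid {p ℕ.* p})
      positive : ∀ e c → 0 ℕ.< e ℕ.+ r ℕ.* suc c
      positive e c = ℕ.<-≤-trans ℕ.z<s (ℕ.m≤n+m (r ℕ.* suc c) e)
      c₁ c₂ k m : ℕ
      c₁ = proj₁ (residue e₁ (A S))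
      c₂ = proj₁ (residue e₂ (B S))
      k  = e₁ ℕ.+ r ℕ.* suc c₁
      m  = e₂ ℕ.+ r ℕ.* suc c₂
      k≡A : + k ≡ A S [mod p ℕ.* p ]
      k≡A = proj₂ (residue e₁ (A S))
      m≡B : + m ≡ B S [mod p ℕ.* p ]
      m≡B = proj₂ (residue e₂ (B S))
      Kᵏ*Mᵐ≡target : (+ k) ^ k * (+ m) ^ m ≡ - ⟦ ε ⟧ [mod p ℕ.* p ]
      Kᵏ*Mᵐ≡target = mod-trans
        (*-cong-mod (mod-trans (^-congˡ-mod k k≡A) (^-periodic-mod r e₁ (suc c₁) (A-root S)))
                    (mod-trans (^-congˡ-mod m m≡B) (^-periodic-mod r e₂ (suc c₂) (B-root S))))
        target

    sqrt-of-one : ∀ {z} → z * z ≡ 1ℤ [mod p ℕ.* p ] → z ≡ 1ℤ [mod p ℕ.* p ] ⊎ z ≡ -1ℤ [mod p ℕ.* p ]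
    sqrt-of-one {z} z²≡1 = [ z≡1 , z≡-1 ]′ (prime∣*⇒∣⊎∣ p-prime (z - 1ℤ) (z + 1ℤ) p∣[z-1][z+1])
      where
      p²∣[z-1][z+1] : + (p ℕ.* p) ∣ (z - 1ℤ) * (z + 1ℤ)
      p²∣[z-1][z+1] = subst (+ (p ℕ.* p) ∣_) (difference-of-squares z) (to-∣ z²≡1)
        where
        difference-of-squares : ∀ z → z * z - 1ℤ ≡ (z - 1ℤ) * (z + 1ℤ)
        difference-of-squares = solve-∀
      p∣[z-1][z+1] : + p ∣ (z - 1ℤ) * (z + 1ℤ)
      p∣[z-1][z+1] = ∣-trans (∣ᵤ⇒∣ (ℕ.m∣m*n p)) p²∣[z-1][z+1]
      p∤2 : ¬ + p ∣ + 2
      p∤2 p∣2 = ℕ.<⇒≱ 2<p (ℕ.∣⇒≤ (∣⇒∣ᵤ p∣2))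
      p∣both⇒p∣2 : + p ∣ z - 1ℤ → + p ∣ z + 1ℤ → + p ∣ + 2
      p∣both⇒p∣2 p∣z-1 p∣z+1 = subst (+ p ∣_) (two z) (∣m∣n⇒∣m-n p∣z+1 p∣z-1)
        where
        two : ∀ z → (z + 1ℤ) - (z - 1ℤ) ≡ + 2
        two = solve-∀
      z≡1 : + p ∣ z - 1ℤ → z ≡ 1ℤ [mod p ℕ.* p ] ⊎ z ≡ -1ℤ [mod p ℕ.* p ]
      z≡1 p∣z-1 = inj₁ (from-∣ (p²∣*⇒p²∣ p-prime (p∤2 ∘ p∣both⇒p∣2 p∣z-1)
        (subst (+ (p ℕ.* p) ∣_) (*-comm (z - 1ℤ) (z + 1ℤ)) p²∣[z-1][z+1])))
      z≡-1 : + p ∣ z + 1ℤ → z ≡ 1ℤ [mod p ℕ.* p ] ⊎ z ≡ -1ℤ [mod p ℕ.* p ]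
      z≡-1 p∣z+1 = inj₂ (from-∣ (subst (+ (p ℕ.* p) ∣_) (plus-one z)
        (p²∣*⇒p²∣ p-prime (p∤2 ∘ flip p∣both⇒p∣2 p∣z+1) p²∣[z-1][z+1])))
        where
        plus-one : ∀ z → z + 1ℤ ≡ z - -1ℤ
        plus-one = solve-∀

    square-root-step : ∀ {z} → OddPower (z * z) ⊎ MinusOnePower (z * z) → OddPower z ⊎ MinusOnePower z
    square-root-step {z} (inj₂ (j , z²ʲ≡-1)) =
      inj₂ (j ℕ.+ j , mod-trans (mod-reflexive (sym (square-^ z j))) z²ʲ≡-1)
    square-root-step {z} (inj₁ (o , z²ˢ≡1)) =
      [ (λ zˢ≡1 → inj₁ (o , zˢ≡1)) , (λ zˢ≡-1 → inj₂ (suc (o ℕ.+ o) , zˢ≡-1)) ]′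
      (sqrt-of-one (mod-trans (mod-reflexive (sym (^-distribʳ-* z z (suc (o ℕ.+ o))))) z²ˢ≡1))

    odd-power-or-minus-one : ∀ e {z} → z ^ suc e ≡ 1ℤ [mod p ℕ.* p ] → OddPower z ⊎ MinusOnePower z
    odd-power-or-minus-one = <-rec Claim step
      where
      Claim : ℕ → Set
      Claim e = ∀ {z} → z ^ suc e ≡ 1ℤ [mod p ℕ.* p ] → OddPower z ⊎ MinusOnePower z
      step : ∀ e → (∀ {e′} → e′ ℕ.< e → Claim e′) → Claim e
      step e rec {z} zᵉ⁺¹≡1 with even⊎odd (suc e)
      ... | o     , inj₂ 1+e≡1+o+o = inj₁ (o , subst (λ n → z ^ n ≡ 1ℤ [mod p ℕ.* p ]) 1+e≡1+o+o zᵉ⁺¹≡1)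
      ... | suc j , inj₁ 1+e≡j+j   = square-root-step (rec j<e (mod-trans (mod-reflexive z²ʲ≡zᵉ⁺¹) zᵉ⁺¹≡1))
        where
        z²ʲ≡zᵉ⁺¹ : (z * z) ^ suc j ≡ z ^ suc e
        z²ʲ≡zᵉ⁺¹ = trans (square-^ z (suc j)) (cong (z ^_) (sym 1+e≡j+j))
        j<e : j ℕ.< e
        j<e = subst (j ℕ.<_) (sym (ℕ.suc-injective 1+e≡j+j)) (ℕ.m<m+n j ℕ.z<s)

    invert-split : (S : SplitOne) → ∀ {i} → B S * i ≡ 1ℤ [mod p ℕ.* p ] → SplitOne
    invert-split S {i} Bi≡1 = record
      { A = - (A S * i) ; B = i
      ; A-root = -‿root {A S * i} (mod-trans (mod-reflexive (^-distribʳ-* (A S) i r)) (*-cong-mod (A-root S) i-root))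
      ; B-root = i-root
      ; A+B≡1  = begin
          - (A S * i) + i    ≡⟨ factor (A S) i ⟩
          (1ℤ - A S) * i     ≈⟨ *-congʳ-mod i 1-A≡B ⟩
          B S * i            ≈⟨ Bi≡1 ⟩
          1ℤ ∎
      }
      where
      open import Relation.Binary.Reasoning.Setoid (mod-setoid {p ℕ.* p})
      i-root : RootOfUnity i
      i-root = inverse-^-≡1-mod {x = B S} {y = i} r Bi≡1 (B-root S)
      factor : ∀ a b → - (a * b) + b ≡ (1ℤ - a) * b
      factor = solve-∀
      1-A≡B : 1ℤ - A S ≡ B S [mod p ℕ.* p ]
      1-A≡B = begin
        1ℤ - A S            ≈⟨ +-cong-mod (mod-sym (A+B≡1 S)) (mod-refl {x = - A S}) ⟩
        A S + B S - A S     ≡⟨ cancel (A S) (B S) ⟩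
        B S ∎
        where
        cancel : ∀ a b → a + b - a ≡ b
        cancel = solve-∀

    -- An odd common multiple of the orders of A and B sends −A/B to −1.
    odd-powers⇒minus-one : (S : SplitOne) → OddPower (A S) → OddPower (B S) → MinusOneReachable
    odd-powers⇒minus-one S (o₁ , Aˢ¹≡1) (o₂ , Bˢ²≡1) =
      invert-split S B*Bi≡1 , suc (w ℕ.+ w) , 0 , mod-trans (mod-reflexive (*-identityʳ _)) A′ʷ≡-1
      where
      open import Relation.Binary.Reasoning.Setoid (mod-setoid {p ℕ.* p})
      s₁ s₂ w : ℕ
      s₁ = suc (o₁ ℕ.+ o₁)
      s₂ = suc (o₂ ℕ.+ o₂)
      w  = o₁ ℕ.* s₂ ℕ.+ o₂
      s₁s₂≡1+w+w : s₁ ℕ.* s₂ ≡ suc (w ℕ.+ w)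
      s₁s₂≡1+w+w = odd*odd o₁ o₂
        where
        odd*odd : ∀ a b → suc (a ℕ.+ a) ℕ.* suc (b ℕ.+ b)
                          ≡ suc ((a ℕ.* suc (b ℕ.+ b) ℕ.+ b) ℕ.+ (a ℕ.* suc (b ℕ.+ b) ℕ.+ b))
        odd*odd = ℕ-Solver.solve-∀
      Bi : ℤ
      Bi = proj₁ (inverse-mod-p² p-prime (root⇒∤ {B S} (B-root S)))
      B*Bi≡1 : B S * Bi ≡ 1ℤ [mod p ℕ.* p ]
      B*Bi≡1 = proj₂ (inverse-mod-p² p-prime (root⇒∤ {B S} (B-root S)))
      Aʷ≡1 : A S ^ suc (w ℕ.+ w) ≡ 1ℤ [mod p ℕ.* p ]
      Aʷ≡1 = subst (λ e → A S ^ e ≡ 1ℤ [mod p ℕ.* p ]) s₁s₂≡1+w+w (^-*-≡1-mod {x = A S} s₁ s₂ Aˢ¹≡1)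
      Bʷ≡1 : B S ^ suc (w ℕ.+ w) ≡ 1ℤ [mod p ℕ.* p ]
      Bʷ≡1 = subst (λ e → B S ^ e ≡ 1ℤ [mod p ℕ.* p ]) (trans (ℕ.*-comm s₂ s₁) s₁s₂≡1+w+w)
                   (^-*-≡1-mod {x = B S} s₂ s₁ Bˢ²≡1)
      A′ʷ≡-1 : (- (A S * Bi)) ^ suc (w ℕ.+ w) ≡ -1ℤ [mod p ℕ.* p ]
      A′ʷ≡-1 = begin
        (- (A S * Bi)) ^ suc (w ℕ.+ w)                 ≡⟨ -‿^-odd (A S * Bi) w ⟩
        - (A S * Bi) ^ suc (w ℕ.+ w)                   ≡⟨ cong -_ (^-distribʳ-* (A S) Bi (suc (w ℕ.+ w))) ⟩
        - (A S ^ suc (w ℕ.+ w) * Bi ^ suc (w ℕ.+ w))   ≈⟨ -‿cong-mod (*-cong-mod Aʷ≡1 Biʷ≡1) ⟩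
        -1ℤ ∎
        where
        Biʷ≡1 : Bi ^ suc (w ℕ.+ w) ≡ 1ℤ [mod p ℕ.* p ]
        Biʷ≡1 = inverse-^-≡1-mod {x = B S} {y = Bi} (suc (w ℕ.+ w)) B*Bi≡1 Bʷ≡1

    minus-one-reachable : SplitOne → MinusOneReachable
    minus-one-reachable S = by-orders (odd-power-or-minus-one (h ℕ.+ suc h) (A-root S))
                                      (odd-power-or-minus-one (h ℕ.+ suc h) (B-root S))
      where
      by-orders : OddPower (A S) ⊎ MinusOnePower (A S) → OddPower (B S) ⊎ MinusOnePower (B S) →
                  MinusOneReachable
      by-orders (inj₂ (j , Aʲ≡-1)) _                  = S , j , 0 , mod-trans (mod-reflexive (*-identityʳ _)) Aʲ≡-1
      by-orders (inj₁ _)           (inj₂ (j , Bʲ≡-1)) = S , 0 , j , mod-trans (mod-reflexive (*-identityˡ _)) Bʲ≡-1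
      by-orders (inj₁ A-odd)       (inj₁ B-odd)       = odd-powers⇒minus-one S A-odd B-odd

    InCons⇒InP : ∀ ε → InCons p → InP ε p
    InCons⇒InP minus c = Solution⇒InP p-prime (realise minus (InCons⇒SplitOne c) 0 0 mod-refl)
    InCons⇒InP plus  c = realise-minus-one (minus-one-reachable (InCons⇒SplitOne c))
      where
      realise-minus-one : MinusOneReachable → InP plus p
      realise-minus-one (S , e₁ , e₂ , target) = Solution⇒InP p-prime (realise plus S e₁ e₂ target)

InP⇒InCons : ∀ ε p → InP ε p → InCons p
InP⇒InCons ε p inP@(p-prime , _) with prime⇒two⊎odd p-prime
... | inj₁ refl       = ⊥-elim (two∉InP ε inP)
... | inj₂ (h , refl) = OddPrime.InP⇒InCons h p-prime {ε} inP

InCons⇒InP : ∀ ε p → InCons p → InP ε p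
InCons⇒InP ε p c@(p-prime , _) with prime⇒two⊎odd p-prime
... | inj₁ refl       = ⊥-elim (two∉InCons c)
... | inj₂ (h , refl) = OddPrime.InCons⇒InP h p-prime ε c

theorem1p2 : (p : ℕ) → (InP plus p ⇔ InCons p) × (InP minus p ⇔ InCons p)
theorem1p2 p = mk⇔ (InP⇒InCons plus  p) (InCons⇒InP plus  p)
             , mk⇔ (InP⇒InCons minus p) (InCons⇒InP minus p)
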